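{- Let $G$ and $H$ be graphs on the same labeled vertex set $V$ with the same degree sequence, i.e. $\deg_G(v)=\deg_H(v)$ for every $v\in V$. Then $\operatorname{act}(G)=\operatorname{act}(H)$. In other words, applying a 2-switch to a graph does not change its set of active vertices (nor its set of inactive vertices).
   Context: All graphs are finite, simple and labeled. A 2-switch acting on a graph $G$ is given by four distinct vertices $a,b,c,d$ with $ab,cd\in E(G)$ and $ac,bd\notin E(G)$; it transforms $G$ into $(G-\{ab,cd\})+\{ac,bd\}$ on the same vertex set, and we say it activates $a,b,c,d$. A vertex $v$ of $G$ is active in $G$ if there is a set $W$ of four vertices containing $v$ such that the induced subgraph $\langle W\rangle_G$ is isomorphic to $P_4$, $C_4$ or $2K_2$ (equivalently, some 2-switch acting on $G$ activates $v$); otherwise $v$ is inactive. $\operatorname{act}(G)$ denotes the set of active vertices of $G$. -}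

module Defs where

open import Data.Nat using (ℕ)
open import Data.Bool using (Bool; true; false)
open import Data.Fin using (Fin)
open import Data.List using (List; length; filter)
open import Data.List using () renaming (allFin to allFinL)
open import Data.Product using (_×_; ∃-syntax)
open import Data.Sum using (_⊎_)
open import Relation.Binary.PropositionalEquality using (_≡_; _≢_)
open import Relation.Nullary using (¬_)
open import Relation.Nullary.Decidable using (does)
open import Data.Bool.Properties using () renaming (_≟_ to _≟ᵇ_)

record Graph (n : ℕ) : Set where
  field
    adj   : Fin n → Fin n → Bool
    sym   : ∀ u v → adj u v ≡ adj v u
    irrefl : ∀ v → adj v v ≡ false
open Graph public

Edge : ∀ {n} → Graph n → Fin n → Fin n → Set
Edge G u v = adj G u v ≡ true

NonEdge : ∀ {n} → Graph n → Fin n → Fin n → Set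
NonEdge G u v = adj G u v ≡ false

deg : ∀ {n} → Graph n → Fin n → ℕ
deg {n} G v = length (filter (λ u → adj G v u ≟ᵇ true) (allFinL n))

Distinct4 : ∀ {n} → Fin n → Fin n → Fin n → Fin n → Set
Distinct4 a b c d =
  (a ≢ b) × (a ≢ c) × (a ≢ d) × (b ≢ c) × (b ≢ d) × (c ≢ d)

IsP4 : ∀ {n} → Graph n → Fin n → Fin n → Fin n → Fin n → Set
IsP4 G a b c d = Edge G a b × Edge G b c × Edge G c d
               × NonEdge G a c × NonEdge G b d × NonEdge G a d

IsC4 : ∀ {n} → Graph n → Fin n → Fin n → Fin n → Fin n → Set
IsC4 G a b c d = Edge G a b × Edge G b c × Edge G c d
               × Edge G d a × NonEdge G a c × NonEdge G b d

Is2K2 : ∀ {n} → Graph n → Fin n → Fin n → Fin n → Fin n → Set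
Is2K2 G a b c d = Edge G a b × Edge G c d
                × NonEdge G a c × NonEdge G a d × NonEdge G b c × NonEdge G b d

OneOf4 : ∀ {n} → Fin n → Fin n → Fin n → Fin n → Fin n → Set
OneOf4 v a b c d = (v ≡ a) ⊎ (v ≡ b) ⊎ (v ≡ c) ⊎ (v ≡ d)

-- v is active in G: some 4-set W = {a,b,c,d} containing v induces
-- a subgraph isomorphic to P4, C4 or 2K2.  (An isomorphism from one of
-- these patterns onto ⟨W⟩ is exactly an enumeration a,b,c,d of W
-- realising the pattern.)
Active : ∀ {n} → Graph n → Fin n → Set
Active G v = ∃[ a ] ∃[ b ] ∃[ c ] ∃[ d ]
  ( Distinct4 a b c d × OneOf4 v a b c d
  × (IsP4 G a b c d ⊎ IsC4 G a b c d ⊎ Is2K2 G a b c d))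

-- Write N = N_G(v) and F = V ∖ N_G[v]. A vertex v is inactive exactly when every
-- vertex w with a neighbour in F is adjacent to all of N ∖ {w}; so in G the number of
-- neighbours of w in N is maximal whenever w has a neighbour in F. Let H have the same
-- degrees and split deg w = [wv] + deg_N w + deg_F w in both graphs. Maximality in G
-- gives deg_F^G ≤ deg_F^H on N and deg_N^H ≤ deg_N^G on F; summing, both sides count
-- the N–F edges, once of G and once of H, so all these inequalities are equalities.
-- A pigeonhole argument on deg v then shows N_H(v) = N, the two degree splits agree
-- away from v, and inactivity of v carries over to H. Activity is decidable, so
-- inactivity transferring in both directions gives the equivalence.
module Submission where

open import Defs renaming (sym to adj-sym; irrefl to adj-irrefl)
open import Data.Nat using (ℕ; zero; suc; _+_; _*_; _≤_; _<_; z≤n; s≤s; _<?_)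
open import Data.Nat.Properties
  using ( ≤-refl; ≤-reflexive; ≤-trans; ≤-antisym; ≮⇒≥; <⇒≱; 1+n≰n; n≤0⇒n≡0; m≤m+n; m≤n+m
        ; +-comm; +-assoc; +-suc; +-identityʳ; *-identityˡ; *-distribʳ-+
        ; +-mono-≤; +-monoˡ-≤; +-mono-<-≤; +-mono-≤-<; *-monoʳ-≤
        ; +-cancelˡ-≤; +-cancelʳ-≤; +-cancelˡ-≡; +-cancelʳ-≡
        ; +-*-semiring; *-commutativeSemigroup; module ≤-Reasoning )
open import Data.Bool using (Bool; true; false; not; _∨_; _∧_)
open import Data.Bool.Properties using () renaming (_≟_ to _≟ᵇ_)
open import Data.Fin using (Fin; zero; suc)
open import Data.Fin.Properties using (_≟_; any?)
open import Data.List using (length; filter; tabulate)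
open import Data.Product using (∃; ∃-syntax; _×_; _,_; proj₁; proj₂)
open import Data.Sum using (_⊎_; inj₁; inj₂)
open import Function using (_∘_)
open import Function.Bundles using (_⇔_; mk⇔)
open import Relation.Binary.PropositionalEquality
  using (_≡_; _≢_; _≗_; refl; sym; ≢-sym; trans; cong; cong₂; subst; subst₂; module ≡-Reasoning)
open import Relation.Nullary using (¬_; Dec; yes; no; does; contradiction)
open import Relation.Nullary.Decidable using (dec-false; _×-dec_; ¬?)
open import Relation.Unary using (Pred; Decidable)
open import Algebra.Properties.CommutativeSemigroup *-commutativeSemigroup using (x∙yz≈y∙xz)
open import Algebra.Properties.Semiring.Sum +-*-semiring
  using (sum; sum-syntax; ∑-distrib-+; ∑-comm; *-distribˡ-sum; sum-cong-≗; sum-replicate-zero)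

𝟙 : Bool → ℕ
𝟙 true  = 1
𝟙 false = 0

𝟙≤1 : ∀ b → 𝟙 b ≤ 1
𝟙≤1 true  = ≤-refl
𝟙≤1 false = z≤n

𝟙-*-mono-≤ : ∀ s {x y} → (s ≡ true → x ≤ y) → 𝟙 s * x ≤ 𝟙 s * y
𝟙-*-mono-≤ true  x≤y = *-monoʳ-≤ 1 (x≤y refl)
𝟙-*-mono-≤ false _   = z≤n

𝟙-*-cancel : ∀ {s x y} → s ≡ true → 𝟙 s * x ≡ 𝟙 s * y → x ≡ y
𝟙-*-cancel {x = x} {y} refl eq = trans (sym (*-identityˡ x)) (trans eq (*-identityˡ y))

𝟙-∧-≤ : ∀ s x → 𝟙 (s ∧ x) ≤ 𝟙 s
𝟙-∧-≤ true  x = 𝟙≤1 x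
𝟙-∧-≤ false x = z≤n

𝟙-true-∧ : ∀ {s x} → s ≡ true → 𝟙 (s ∧ x) ≡ 𝟙 s → x ≡ true
𝟙-true-∧ {x = true} refl _ = refl

𝟙-injective : ∀ {a b} → 𝟙 a ≡ 𝟙 b → a ≡ b
𝟙-injective {false} {false} _ = refl
𝟙-injective {true}  {true}  _ = refl

𝟙-<⇒ : ∀ {a b} → 𝟙 a < 𝟙 b → a ≡ false × b ≡ true
𝟙-<⇒ {false} {true} _ = refl , refl
𝟙-<⇒ {true}  {true} (s≤s ())

+-≡⇒≤ : ∀ {x y x′ y′} → x + y ≡ x′ + y′ → x′ ≤ x → y ≤ y′
+-≡⇒≤ {x} {y} {x′} {y′} eq x′≤x = +-cancelˡ-≤ x y y′ (≤-trans (≤-reflexive eq) (+-monoˡ-≤ y′ x′≤x))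

∑-mono-≤ : ∀ {n} {f g : Fin n → ℕ} → (∀ i → f i ≤ g i) → sum f ≤ sum g
∑-mono-≤ {zero}  f≤g = z≤n
∑-mono-≤ {suc n} f≤g = +-mono-≤ (f≤g zero) (∑-mono-≤ (f≤g ∘ suc))

∑-mono-< : ∀ {n} {f g : Fin n → ℕ} → (∀ i → f i ≤ g i) → ∀ i → f i < g i → sum f < sum g
∑-mono-< f≤g zero    fi<gi = +-mono-<-≤ fi<gi (∑-mono-≤ (f≤g ∘ suc))
∑-mono-< f≤g (suc i) fi<gi = +-mono-≤-< (f≤g zero) (∑-mono-< (f≤g ∘ suc) i fi<gi)

∑-mono-≤-equality : ∀ {n} {f g : Fin n → ℕ} → (∀ i → f i ≤ g i) → sum g ≤ sum f → f ≗ g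
∑-mono-≤-equality f≤g ∑g≤∑f i =
  ≤-antisym (f≤g i) (≮⇒≥ λ fi<gi → <⇒≱ (∑-mono-< f≤g i fi<gi) ∑g≤∑f)

∑-≤∧>⇒∃< : ∀ {n} {f g : Fin n → ℕ} → sum f ≤ sum g → ∀ i → g i < f i → ∃ λ j → f j < g j
∑-≤∧>⇒∃< {f = f} {g} ∑f≤∑g i gi<fi with any? (λ j → f j <? g j)
... | yes found = found
... | no  none  =
  contradiction ∑f≤∑g (<⇒≱ (∑-mono-< (λ j → ≮⇒≥ (λ fj<gj → none (j , fj<gj))) i gi<fi))

term≤∑ : ∀ {n} (f : Fin n → ℕ) i → f i ≤ sum f
term≤∑ f zero    = m≤m+n (f zero) _
term≤∑ f (suc i) = ≤-trans (term≤∑ (f ∘ suc) i) (m≤n+m _ (f zero))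

∑-positive : ∀ {n} (f : Fin n → ℕ) → 0 < sum f → ∃ λ i → 0 < f i
∑-positive {suc n} f 0<∑f with f zero in f₀≡
... | suc _ = zero , subst (0 <_) (sym f₀≡) (s≤s z≤n)
... | zero  with ∑-positive (f ∘ suc) 0<∑f
...   | i , 0<fi = suc i , 0<fi

∑-δ : ∀ {n} (w : Fin n) (f : Fin n → ℕ) → ∑[ u < n ] (𝟙 (does (w ≟ u)) * f u) ≡ f w
∑-δ {suc n} zero    f =
  trans (cong₂ _+_ (*-identityˡ (f zero)) (sum-replicate-zero n)) (+-identityʳ (f zero))
∑-δ {suc n} (suc w) f = ∑-δ w (f ∘ suc)

length-filter-tabulate : ∀ {a p} {A : Set a} {P : Pred A p} (P? : Decidable P) {n} (f : Fin n → A)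
  → length (filter P? (tabulate f)) ≡ ∑[ i < n ] 𝟙 (does (P? (f i)))
length-filter-tabulate P? {zero}  f = refl
length-filter-tabulate P? {suc n} f with does (P? (f zero))
... | true  = cong suc (length-filter-tabulate P? (f ∘ suc))
... | false = length-filter-tabulate P? (f ∘ suc)

module _ {n : ℕ} where

  adjℕ : Graph n → Fin n → Fin n → ℕ
  adjℕ K w u = 𝟙 (adj K w u)

  ∣_∣ : (Fin n → Bool) → ℕ
  ∣ S ∣ = ∑[ u < n ] 𝟙 (S u)

  degIn : Graph n → (Fin n → Bool) → Fin n → ℕ
  degIn K S w = ∑[ u < n ] (𝟙 (S u) * adjℕ K w u)

  closedNbhd : Graph n → Fin n → Fin n → Bool
  closedNbhd K w u = does (w ≟ u) ∨ adj K w u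

  farFrom : Graph n → Fin n → Fin n → Bool
  farFrom K v u = not (closedNbhd K v u)

  Dominates : Graph n → Fin n → (Fin n → Bool) → Set
  Dominates K w S = ∀ {u} → S u ≡ true → u ≢ w → Edge K w u

  adj-flip : ∀ (K : Graph n) {u w t} → adj K u w ≡ t → adj K w u ≡ t
  adj-flip K {u} {w} eq = trans (adj-sym K w u) eq

  edge⇒≢ : ∀ (K : Graph n) {u w} → Edge K u w → u ≢ w
  edge⇒≢ K {u} uw refl with trans (sym uw) (adj-irrefl K u)
  ... | ()

  edge⇒¬nonEdge : ∀ (K : Graph n) {u w} → Edge K u w → ¬ NonEdge K u w
  edge⇒¬nonEdge K uw ¬uw with trans (sym uw) ¬uw
  ... | ()

  deg≡∑adjℕ : ∀ (K : Graph n) w → deg K w ≡ sum (adjℕ K w)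
  deg≡∑adjℕ K w = trans (length-filter-tabulate (λ u → adj K w u ≟ᵇ true) (λ u → u))
                        (sum-cong-≗ (λ u → 𝟙-≟true (adj K w u)))
    where
    𝟙-≟true : ∀ b → 𝟙 (does (b ≟ᵇ true)) ≡ 𝟙 b
    𝟙-≟true true  = refl
    𝟙-≟true false = refl

  ∑-degIn-comm : ∀ (K : Graph n) S T →
    ∑[ w < n ] (𝟙 (T w) * degIn K S w) ≡ ∑[ u < n ] (𝟙 (S u) * degIn K T u)
  ∑-degIn-comm K S T = begin
    ∑[ w < n ] (𝟙 (T w) * degIn K S w)
      ≡⟨ sum-cong-≗ (λ w → *-distribˡ-sum (𝟙 (T w)) (λ u → 𝟙 (S u) * adjℕ K w u)) ⟩
    ∑[ w < n ] ∑[ u < n ] (𝟙 (T w) * (𝟙 (S u) * adjℕ K w u))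
      ≡⟨ ∑-comm (λ w u → 𝟙 (T w) * (𝟙 (S u) * adjℕ K w u)) ⟩
    ∑[ u < n ] ∑[ w < n ] (𝟙 (T w) * (𝟙 (S u) * adjℕ K w u))
      ≡⟨ sum-cong-≗ (λ u → sum-cong-≗ (λ w → swap u w)) ⟩
    ∑[ u < n ] ∑[ w < n ] (𝟙 (S u) * (𝟙 (T w) * adjℕ K u w))
      ≡⟨ sum-cong-≗ (λ u → *-distribˡ-sum (𝟙 (S u)) (λ w → 𝟙 (T w) * adjℕ K u w)) ⟨
    ∑[ u < n ] (𝟙 (S u) * degIn K T u) ∎
    where
    open ≡-Reasoning
    swap : ∀ u w → 𝟙 (T w) * (𝟙 (S u) * adjℕ K w u) ≡ 𝟙 (S u) * (𝟙 (T w) * adjℕ K u w)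
    swap u w = trans (x∙yz≈y∙xz (𝟙 (T w)) (𝟙 (S u)) (adjℕ K w u))
                     (cong (λ e → 𝟙 (S u) * (𝟙 (T w) * 𝟙 e)) (adj-sym K w u))

  deg-split : ∀ (K L : Graph n) v w →
    deg K w ≡ adjℕ K w v + degIn K (adj L v) w + degIn K (farFrom L v) w
  deg-split K L v w = begin
    deg K w                                       ≡⟨ deg≡∑adjℕ K w ⟩
    ∑[ u < n ] e u                                ≡⟨ sum-cong-≗ expand ⟩
    ∑[ u < n ] (δ u * e u + N u * e u + F u * e u)
      ≡⟨ ∑-distrib-+ (λ u → δ u * e u + N u * e u) (λ u → F u * e u) ⟩
    ∑[ u < n ] (δ u * e u + N u * e u) + degIn K (farFrom L v) w
      ≡⟨ cong (_+ degIn K (farFrom L v) w) (∑-distrib-+ (λ u → δ u * e u) (λ u → N u * e u)) ⟩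
    ∑[ u < n ] (δ u * e u) + degIn K (adj L v) w + degIn K (farFrom L v) w
      ≡⟨ cong (λ x → x + degIn K (adj L v) w + degIn K (farFrom L v) w) (∑-δ v e) ⟩
    e v + degIn K (adj L v) w + degIn K (farFrom L v) w ∎
    where
    open ≡-Reasoning
    e δ N F : Fin n → ℕ
    e u = adjℕ K w u
    δ u = 𝟙 (does (v ≟ u))
    N u = 𝟙 (adj L v u)
    F u = 𝟙 (farFrom L v u)
    partition : ∀ u → δ u + N u + F u ≡ 1
    partition u with v ≟ u
    ... | yes refl rewrite adj-irrefl L v = refl
    ... | no _ with adj L v u
    ...   | true  = refl
    ...   | false = refl
    expand : ∀ u → e u ≡ δ u * e u + N u * e u + F u * e u
    expand u = begin
      e u                        ≡⟨ *-identityˡ (e u) ⟨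
      1 * e u                    ≡⟨ cong (_* e u) (partition u) ⟨
      (δ u + N u + F u) * e u    ≡⟨ *-distribʳ-+ (e u) (δ u + N u) (F u) ⟩
      (δ u + N u) * e u + F u * e u
                                 ≡⟨ cong (_+ F u * e u) (*-distribʳ-+ (e u) (δ u) (N u)) ⟩
      δ u * e u + N u * e u + F u * e u ∎

  degIn+self≡∑ : ∀ (K : Graph n) S w → degIn K S w + 𝟙 (S w) ≡ ∑[ u < n ] 𝟙 (S u ∧ closedNbhd K w u)
  degIn+self≡∑ K S w = begin
    degIn K S w + 𝟙 (S w)
      ≡⟨ +-comm (degIn K S w) _ ⟩
    𝟙 (S w) + degIn K S w
      ≡⟨ cong (_+ degIn K S w) (∑-δ w (λ u → 𝟙 (S u))) ⟨
    ∑[ u < n ] (𝟙 (does (w ≟ u)) * 𝟙 (S u)) + degIn K S w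
      ≡⟨ ∑-distrib-+ (λ u → 𝟙 (does (w ≟ u)) * 𝟙 (S u)) (λ u → 𝟙 (S u) * adjℕ K w u) ⟨
    ∑[ u < n ] (𝟙 (does (w ≟ u)) * 𝟙 (S u) + 𝟙 (S u) * adjℕ K w u)
      ≡⟨ sum-cong-≗ term≡ ⟩
    ∑[ u < n ] 𝟙 (S u ∧ closedNbhd K w u) ∎
    where
    open ≡-Reasoning
    term≡ : ∀ u → 𝟙 (does (w ≟ u)) * 𝟙 (S u) + 𝟙 (S u) * adjℕ K w u ≡ 𝟙 (S u ∧ closedNbhd K w u)
    term≡ u with w ≟ u | S u
    ... | yes refl | true  rewrite adj-irrefl K w = refl
    ... | yes refl | false = refl
    ... | no _     | true  = +-identityʳ _
    ... | no _     | false = refl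

  closedNbhd⇒edge : ∀ (K : Graph n) {w u} → closedNbhd K w u ≡ true → u ≢ w → Edge K w u
  closedNbhd⇒edge K {w} {u} with w ≟ u
  ... | yes w≡u = λ _ u≢w → contradiction (sym w≡u) u≢w
  ... | no _    = λ wu _ → wu

  degIn+self≤∣∣ : ∀ (K : Graph n) S w → degIn K S w + 𝟙 (S w) ≤ ∣ S ∣
  degIn+self≤∣∣ K S w = ≤-trans (≤-reflexive (degIn+self≡∑ K S w)) (∑-mono-≤ (λ u → 𝟙-∧-≤ (S u) _))

  dominates⇒degIn+self≡∣∣ : ∀ (K : Graph n) S w → Dominates K w S → degIn K S w + 𝟙 (S w) ≡ ∣ S ∣
  dominates⇒degIn+self≡∣∣ K S w dom = trans (degIn+self≡∑ K S w) (sum-cong-≗ term≡)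
    where
    term≡ : ∀ u → 𝟙 (S u ∧ closedNbhd K w u) ≡ 𝟙 (S u)
    term≡ u with S u in Su | w ≟ u
    ... | false | _      = refl
    ... | true  | yes _  = refl
    ... | true  | no w≢u = cong 𝟙 (dom Su (λ u≡w → w≢u (sym u≡w)))

  degIn+self≡∣∣⇒dominates : ∀ (K : Graph n) S w → degIn K S w + 𝟙 (S w) ≡ ∣ S ∣ → Dominates K w S
  degIn+self≡∣∣⇒dominates K S w maximal {u} Su = closedNbhd⇒edge K (𝟙-true-∧ Su (tight u))
    where
    tight : ∀ u → 𝟙 (S u ∧ closedNbhd K w u) ≡ 𝟙 (S u)
    tight = ∑-mono-≤-equality (λ u → 𝟙-∧-≤ (S u) _)
              (≤-reflexive (trans (sym maximal) (degIn+self≡∑ K S w)))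

  degIn-positive⇒ : ∀ (K : Graph n) S w → 0 < degIn K S w → ∃ λ u → S u ≡ true × Edge K w u
  degIn-positive⇒ K S w 0<d with ∑-positive (λ u → 𝟙 (S u) * adjℕ K w u) 0<d
  ... | u , 0<term = u , 𝟙-*-positive (S u) (adj K w u) 0<term
    where
    𝟙-*-positive : ∀ s e → 0 < 𝟙 s * 𝟙 e → s ≡ true × e ≡ true
    𝟙-*-positive true  true  _ = refl , refl
    𝟙-*-positive true  false ()
    𝟙-*-positive false _     ()

  degIn-positive⇐ : ∀ (K : Graph n) S {w u} → S u ≡ true → Edge K w u → 0 < degIn K S w
  degIn-positive⇐ K S {w} {u} Su wu =
    ≤-trans (≤-reflexive (cong₂ (λ s e → 𝟙 s * 𝟙 e) (sym Su) (sym wu)))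
            (term≤∑ (λ u → 𝟙 (S u) * adjℕ K w u) u)

  farFrom⇒ : ∀ (K : Graph n) {v c} → farFrom K v c ≡ true → NonEdge K v c × c ≢ v
  farFrom⇒ K {v} {c} far with v ≟ c | adj K v c
  ... | no v≢c | false = refl , λ c≡v → v≢c (sym c≡v)

  farFrom⇐ : ∀ (K : Graph n) {v c} → NonEdge K v c → c ≢ v → farFrom K v c ≡ true
  farFrom⇐ K {v} {c} vc c≢v rewrite dec-false (v ≟ c) (λ v≡c → c≢v (sym v≡c)) | vc = refl

  -- The 2-switch {vb, cw} ↦ {vc, bw}; the remaining distinctness conditions follow from
  -- the edges and non-edges.
  ActivatingSwitch : Graph n → Fin n → Set
  ActivatingSwitch K v = ∃[ b ] ∃[ c ] ∃[ w ]
    (Edge K v b × Edge K c w × NonEdge K v c × NonEdge K b w × c ≢ v × w ≢ b)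

  switch⇒active : ∀ (K : Graph n) {v} → ActivatingSwitch K v → Active K v
  switch⇒active K {v} (b , c , w , vb , cw , ¬vc , ¬bw , c≢v , w≢b) =
    shape (adj K v w) refl (adj K b c) refl
    where
    v≢w : v ≢ w
    v≢w refl = edge⇒¬nonEdge K (adj-flip K cw) ¬vc
    b≢c : b ≢ c
    b≢c refl = edge⇒¬nonEdge K vb ¬vc
    distinct : Distinct4 v b c w
    distinct = edge⇒≢ K vb , ≢-sym c≢v , v≢w , b≢c , ≢-sym w≢b , edge⇒≢ K cw
    shape : ∀ x → adj K v w ≡ x → ∀ y → adj K b c ≡ y → Active K v
    shape false ¬vw false ¬bc = v , b , c , w , distinct
      , inj₁ refl , inj₂ (inj₂ (vb , cw , ¬vc , ¬vw , ¬bc , ¬bw))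
    shape false ¬vw true bc = v , b , c , w , distinct
      , inj₁ refl , inj₁ (vb , bc , cw , ¬vc , ¬bw , ¬vw)
    shape true vw false ¬bc = b , v , w , c
      , (≢-sym (edge⇒≢ K vb) , ≢-sym w≢b , b≢c , v≢w , ≢-sym c≢v , ≢-sym (edge⇒≢ K cw))
      , inj₂ (inj₁ refl) , inj₁ (adj-flip K vb , vw , adj-flip K cw , ¬bw , ¬vc , ¬bc)
    shape true vw true bc = v , b , c , w , distinct
      , inj₁ refl , inj₂ (inj₁ (vb , bc , cw , adj-flip K vw , ¬vc , ¬bw))

  active⇒switch : ∀ (K : Graph n) {v} → Active K v → ActivatingSwitch K v
  active⇒switch K {v} (a , b , c , d , (_ , a≢c , a≢d , b≢c , b≢d , _) , position , induced) =
    witness position induced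
    where
    flip : ∀ {x y t} → adj K x y ≡ t → adj K y x ≡ t
    flip = adj-flip K
    witness : OneOf4 v a b c d → IsP4 K a b c d ⊎ IsC4 K a b c d ⊎ Is2K2 K a b c d
            → ActivatingSwitch K v
    witness (inj₁ refl) (inj₁ (ab , _ , cd , ¬ac , ¬bd , _)) =
      b , c , d , ab , cd , ¬ac , ¬bd , ≢-sym a≢c , ≢-sym b≢d
    witness (inj₂ (inj₁ refl)) (inj₁ (ab , _ , cd , ¬ac , ¬bd , _)) =
      a , d , c , flip ab , flip cd , ¬bd , ¬ac , ≢-sym b≢d , ≢-sym a≢c
    witness (inj₂ (inj₂ (inj₁ refl))) (inj₁ (ab , _ , cd , ¬ac , ¬bd , _)) =
      d , a , b , cd , ab , flip ¬ac , flip ¬bd , a≢c , b≢d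
    witness (inj₂ (inj₂ (inj₂ refl))) (inj₁ (ab , _ , cd , ¬ac , ¬bd , _)) =
      c , b , a , flip cd , flip ab , flip ¬bd , flip ¬ac , b≢d , a≢c
    witness (inj₁ refl) (inj₂ (inj₁ (ab , _ , cd , _ , ¬ac , ¬bd))) =
      b , c , d , ab , cd , ¬ac , ¬bd , ≢-sym a≢c , ≢-sym b≢d
    witness (inj₂ (inj₁ refl)) (inj₂ (inj₁ (_ , bc , _ , da , ¬ac , ¬bd))) =
      c , d , a , bc , da , ¬bd , flip ¬ac , ≢-sym b≢d , a≢c
    witness (inj₂ (inj₂ (inj₁ refl))) (inj₂ (inj₁ (ab , _ , cd , _ , ¬ac , ¬bd))) =
      d , a , b , cd , ab , flip ¬ac , flip ¬bd , a≢c , b≢d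
    witness (inj₂ (inj₂ (inj₂ refl))) (inj₂ (inj₁ (_ , bc , _ , da , ¬ac , ¬bd))) =
      a , b , c , da , bc , flip ¬bd , ¬ac , b≢d , ≢-sym a≢c
    witness (inj₁ refl) (inj₂ (inj₂ (ab , cd , ¬ac , _ , _ , ¬bd))) =
      b , c , d , ab , cd , ¬ac , ¬bd , ≢-sym a≢c , ≢-sym b≢d
    witness (inj₂ (inj₁ refl)) (inj₂ (inj₂ (ab , cd , _ , ¬ad , ¬bc , _))) =
      a , c , d , flip ab , cd , ¬bc , ¬ad , ≢-sym b≢c , ≢-sym a≢d
    witness (inj₂ (inj₂ (inj₁ refl))) (inj₂ (inj₂ (ab , cd , ¬ac , _ , _ , ¬bd))) =
      d , a , b , cd , ab , flip ¬ac , flip ¬bd , a≢c , b≢d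
    witness (inj₂ (inj₂ (inj₂ refl))) (inj₂ (inj₂ (ab , cd , _ , ¬ad , ¬bc , _))) =
      c , a , b , flip cd , ab , flip ¬ad , flip ¬bc , a≢d , b≢c

  activatingSwitch? : ∀ (K : Graph n) v → Dec (ActivatingSwitch K v)
  activatingSwitch? K v = any? λ b → any? λ c → any? λ w →
    (adj K v b ≟ᵇ true) ×-dec (adj K c w ≟ᵇ true) ×-dec (adj K v c ≟ᵇ false) ×-dec
    (adj K b w ≟ᵇ false) ×-dec ¬? (c ≟ v) ×-dec ¬? (w ≟ b)

  Inactive : Graph n → Fin n → Set
  Inactive K v = ∀ {c w} → NonEdge K v c → c ≢ v → Edge K c w → Dominates K w (adj K v)

  inactive⇒¬switch : ∀ (K : Graph n) {v} → Inactive K v → ¬ ActivatingSwitch K v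
  inactive⇒¬switch K inactive (b , c , w , vb , cw , ¬vc , ¬bw , c≢v , w≢b) =
    edge⇒¬nonEdge K (adj-flip K (inactive ¬vc c≢v cw vb (≢-sym w≢b))) ¬bw

  ¬switch⇒inactive : ∀ (K : Graph n) {v} → ¬ ActivatingSwitch K v → Inactive K v
  ¬switch⇒inactive K ¬switch {c} {w} ¬vc c≢v cw {b} vb b≢w with adj K w b in wb
  ... | true  = refl
  ... | false = contradiction (b , c , w , vb , cw , ¬vc , adj-flip K wb , c≢v , ≢-sym b≢w) ¬switch

module InactiveTransfer {n} (G H : Graph n) (v : Fin n) (G-inactive : Inactive G v)
                        (same-deg : ∀ w → deg G w ≡ deg H w) where

  near far : Fin n → Bool
  near = adj G v
  far  = farFrom G v

  deg-balance : ∀ w → adjℕ G w v + degIn G near w + degIn G far w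
                    ≡ adjℕ H w v + degIn H near w + degIn H far w
  deg-balance w = trans (sym (deg-split G G v w)) (trans (same-deg w) (deg-split H G v w))

  adjℕ-to-v : ∀ w → adjℕ G w v ≡ 𝟙 (near w)
  adjℕ-to-v w = cong 𝟙 (adj-sym G w v)

  far-neighbour⇒saturated : ∀ {w} → 0 < degIn G far w → degIn G near w + 𝟙 (near w) ≡ ∣ near ∣
  far-neighbour⇒saturated {w} 0<far with degIn-positive⇒ G far w 0<far
  ... | c , far-c , wc with farFrom⇒ G far-c
  ...   | ¬vc , c≢v = dominates⇒degIn+self≡∣∣ G near w (G-inactive ¬vc c≢v (adj-flip G wc))

  far-neighbour⇒nearDeg-H≤G : ∀ {w} → 0 < degIn G far w → degIn H near w ≤ degIn G near w
  far-neighbour⇒nearDeg-H≤G {w} 0<far = +-cancelʳ-≤ (𝟙 (near w)) _ _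
    (≤-trans (degIn+self≤∣∣ H near w) (≤-reflexive (sym (far-neighbour⇒saturated 0<far))))

  nearDeg-H≤G : ∀ {u} → far u ≡ true → degIn H near u ≤ degIn G near u
  nearDeg-H≤G {u} far-u with 0 <? degIn G far u
  ... | yes 0<far = far-neighbour⇒nearDeg-H≤G 0<far
  ... | no  0≮far = begin
    degIn H near u
      ≤⟨ m≤n+m _ (adjℕ H u v) ⟩
    adjℕ H u v + degIn H near u
      ≤⟨ m≤m+n _ (degIn H far u) ⟩
    adjℕ H u v + degIn H near u + degIn H far u
      ≡⟨ deg-balance u ⟨
    adjℕ G u v + degIn G near u + degIn G far u
      ≡⟨ cong₂ (λ x y → x + degIn G near u + y) adj≡0 farDeg≡0 ⟩
    degIn G near u + 0
      ≡⟨ +-identityʳ _ ⟩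
    degIn G near u ∎
    where
    open ≤-Reasoning
    adj≡0 : adjℕ G u v ≡ 0
    adj≡0 = trans (adjℕ-to-v u) (cong 𝟙 (proj₁ (farFrom⇒ G far-u)))
    farDeg≡0 : degIn G far u ≡ 0
    farDeg≡0 = n≤0⇒n≡0 (≮⇒≥ 0≮far)

  farDeg-G≤H : ∀ {w} → near w ≡ true → degIn G far w ≤ degIn H far w
  farDeg-G≤H {w} near-w with 0 <? degIn G far w
  ... | yes 0<far = +-≡⇒≤ (deg-balance w) (+-mono-≤ adj-H≤G (far-neighbour⇒nearDeg-H≤G 0<far))
    where
    adj-H≤G : adjℕ H w v ≤ adjℕ G w v
    adj-H≤G = ≤-trans (𝟙≤1 (adj H w v)) (≤-reflexive (sym (trans (adjℕ-to-v w) (cong 𝟙 near-w))))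
  ... | no  0≮far = subst (_≤ degIn H far w) (sym (n≤0⇒n≡0 (≮⇒≥ 0≮far))) z≤n

  crossing : Graph n → ℕ
  crossing K = ∑[ w < n ] (𝟙 (near w) * degIn K far w)

  crossing-from-far : ∀ K → crossing K ≡ ∑[ u < n ] (𝟙 (far u) * degIn K near u)
  crossing-from-far K = ∑-degIn-comm K far near

  crossing-G≤H : crossing G ≤ crossing H
  crossing-G≤H = ∑-mono-≤ (λ w → 𝟙-*-mono-≤ (near w) farDeg-G≤H)

  crossing-H≤G : crossing H ≤ crossing G
  crossing-H≤G = begin
    crossing H                                ≡⟨ crossing-from-far H ⟩
    ∑[ u < n ] (𝟙 (far u) * degIn H near u)   ≤⟨ ∑-mono-≤ (λ u → 𝟙-*-mono-≤ (far u) nearDeg-H≤G) ⟩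
    ∑[ u < n ] (𝟙 (far u) * degIn G near u)   ≡⟨ crossing-from-far G ⟨
    crossing G                                ∎
    where open ≤-Reasoning

  farDeg-≡ : ∀ {w} → near w ≡ true → degIn G far w ≡ degIn H far w
  farDeg-≡ {w} near-w =
    𝟙-*-cancel near-w (∑-mono-≤-equality (λ w → 𝟙-*-mono-≤ (near w) farDeg-G≤H) crossing-H≤G w)

  nearDeg-≡ : ∀ {u} → far u ≡ true → degIn H near u ≡ degIn G near u
  nearDeg-≡ {u} far-u = 𝟙-*-cancel far-u (∑-mono-≤-equality (λ u → 𝟙-*-mono-≤ (far u) nearDeg-H≤G)
    (subst₂ _≤_ (crossing-from-far G) (crossing-from-far H) crossing-G≤H) u)

  far-neighbour⇒stays-adjacent : ∀ {w} → near w ≡ true → 0 < degIn G far w → Edge H v w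
  far-neighbour⇒stays-adjacent {w} near-w 0<far with adj H w v in wv
  ... | true  = adj-flip H wv
  ... | false =
    contradiction (≤-trans (≤-reflexive 1+nearDeg-G≡H) (far-neighbour⇒nearDeg-H≤G 0<far)) 1+n≰n
    where
    1+nearDeg-G≡H : 1 + degIn G near w ≡ degIn H near w
    1+nearDeg-G≡H = +-cancelʳ-≡ (degIn G far w) _ _ (begin
      1 + degIn G near w + degIn G far w
        ≡⟨ cong (λ x → x + degIn G near w + degIn G far w) (trans (adjℕ-to-v w) (cong 𝟙 near-w)) ⟨
      adjℕ G w v + degIn G near w + degIn G far w
        ≡⟨ deg-balance w ⟩
      adjℕ H w v + degIn H near w + degIn H far w
        ≡⟨ cong₂ (λ x y → x + degIn H near w + y) (cong 𝟙 wv) (sym (farDeg-≡ near-w)) ⟩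
      degIn H near w + degIn G far w ∎)
      where open ≡-Reasoning

  adjacent-in-H⇒far-neighbour : ∀ {u} → far u ≡ true → Edge H v u → 0 < degIn G far u
  adjacent-in-H⇒far-neighbour {u} far-u vu = subst (0 <_) (sym farDeg≡suc) (s≤s z≤n)
    where
    farDeg≡suc : degIn G far u ≡ suc (degIn H far u)
    farDeg≡suc = +-cancelˡ-≡ (degIn G near u) _ _ (begin
      degIn G near u + degIn G far u
        ≡⟨ cong (λ x → x + degIn G near u + degIn G far u) (trans (adjℕ-to-v u) (cong 𝟙 ¬vu)) ⟨
      adjℕ G u v + degIn G near u + degIn G far u
        ≡⟨ deg-balance u ⟩
      adjℕ H u v + degIn H near u + degIn H far u
        ≡⟨ cong₂ (λ x y → x + y + degIn H far u) (cong 𝟙 (adj-flip H vu)) (nearDeg-≡ far-u) ⟩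
      suc (degIn G near u + degIn H far u)
        ≡⟨ +-suc (degIn G near u) (degIn H far u) ⟨
      degIn G near u + suc (degIn H far u) ∎)
      where
      open ≡-Reasoning
      ¬vu : NonEdge G v u
      ¬vu = proj₁ (farFrom⇒ G far-u)

  ∑adjℕ-H-v≡∣near∣ : sum (adjℕ H v) ≡ ∣ near ∣
  ∑adjℕ-H-v≡∣near∣ = trans (sym (deg≡∑adjℕ H v)) (trans (sym (same-deg v)) (deg≡∑adjℕ G v))

  -- As deg_H v = |N|, a new H-neighbour u ∈ F pushes some y ∈ N out of N_H(v); but then
  -- u has a G-neighbour in F, so it dominates N in G, and y, being adjacent to u ∈ F,
  -- must stay.
  far⇒stays-nonadjacent : ∀ {u} → far u ≡ true → NonEdge H v u
  far⇒stays-nonadjacent {u} far-u with adj H v u in vu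
  ... | false = refl
  ... | true  = contradiction (far-neighbour⇒stays-adjacent near-y (degIn-positive⇐ G far far-u yu))
                              (λ vy → edge⇒¬nonEdge H vy ¬vy)
    where
    dropped : ∃ λ y → adjℕ H v y < 𝟙 (near y)
    dropped = ∑-≤∧>⇒∃< (≤-reflexive ∑adjℕ-H-v≡∣near∣) u
      (subst₂ (λ a b → 𝟙 a < 𝟙 b) (sym (proj₁ (farFrom⇒ G far-u))) (sym vu) ≤-refl)
    y : Fin n
    y = proj₁ dropped
    ¬vy : NonEdge H v y
    ¬vy = proj₁ (𝟙-<⇒ (proj₂ dropped))
    near-y : near y ≡ true
    near-y = proj₂ (𝟙-<⇒ (proj₂ dropped))
    y≢u : y ≢ u
    y≢u y≡u = edge⇒¬nonEdge G (subst (Edge G v) y≡u near-y) (proj₁ (farFrom⇒ G far-u))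
    u-dominates : Dominates G u near
    u-dominates = degIn+self≡∣∣⇒dominates G near u
      (far-neighbour⇒saturated (adjacent-in-H⇒far-neighbour far-u vu))
    yu : Edge G y u
    yu = adj-flip G (u-dominates near-y y≢u)

  same-neighbourhood : ∀ u → adj H v u ≡ adj G v u
  same-neighbourhood = 𝟙-injective ∘ ∑-mono-≤-equality H≤G (≤-reflexive (sym ∑adjℕ-H-v≡∣near∣))
    where
    H≤G : ∀ u → adjℕ H v u ≤ 𝟙 (near u)
    H≤G u with adj G v u in vu | v ≟ u
    ... | true  | _        = 𝟙≤1 (adj H v u)
    ... | false | yes refl = ≤-reflexive (cong 𝟙 (adj-irrefl H v))
    ... | false | no v≢u   = ≤-reflexive (cong 𝟙 (far⇒stays-nonadjacent (farFrom⇐ G vu (≢-sym v≢u))))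

  degIn-sum-≡ : ∀ w → degIn H near w + degIn H far w ≡ degIn G near w + degIn G far w
  degIn-sum-≡ w = +-cancelˡ-≡ (adjℕ G w v) _ _ (begin
    adjℕ G w v + (degIn H near w + degIn H far w)
      ≡⟨ +-assoc (adjℕ G w v) _ _ ⟨
    adjℕ G w v + degIn H near w + degIn H far w
      ≡⟨ cong (λ x → x + degIn H near w + degIn H far w) adj-to-v-≡ ⟨
    adjℕ H w v + degIn H near w + degIn H far w
      ≡⟨ deg-balance w ⟨
    adjℕ G w v + degIn G near w + degIn G far w
      ≡⟨ +-assoc (adjℕ G w v) _ _ ⟩
    adjℕ G w v + (degIn G near w + degIn G far w) ∎)
    where
    open ≡-Reasoning
    adj-to-v-≡ : adjℕ H w v ≡ adjℕ G w v
    adj-to-v-≡ = cong 𝟙 (trans (adj-sym H w v) (trans (same-neighbourhood w) (adj-sym G v w)))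

  same-degIn : ∀ {w} → w ≢ v → degIn H near w ≡ degIn G near w × degIn H far w ≡ degIn G far w
  same-degIn {w} w≢v with adj G v w in vw
  ... | true  =
    +-cancelʳ-≡ (degIn G far w) _ _ (trans (cong (degIn H near w +_) (farDeg-≡ vw)) (degIn-sum-≡ w))
    , sym (farDeg-≡ vw)
  ... | false =
    nearDeg-≡ far-w
    , +-cancelˡ-≡ (degIn G near w) _ _ (trans (cong (_+ degIn H far w) (sym (nearDeg-≡ far-w))) (degIn-sum-≡ w))
    where
    far-w : far w ≡ true
    far-w = farFrom⇐ G vw w≢v

  H-inactive : Inactive H v
  H-inactive {c} {w} ¬vc c≢v cw {b} vb = H-dominates (trans (sym (same-neighbourhood b)) vb)
    where
    far-c : far c ≡ true
    far-c = farFrom⇐ G (trans (sym (same-neighbourhood c)) ¬vc) c≢v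
    w≢v : w ≢ v
    w≢v refl = edge⇒¬nonEdge H (adj-flip H cw) ¬vc
    0<farDeg-G : 0 < degIn G far w
    0<farDeg-G = subst (0 <_) (proj₂ (same-degIn w≢v)) (degIn-positive⇐ H far far-c (adj-flip H cw))
    H-dominates : Dominates H w near
    H-dominates = degIn+self≡∣∣⇒dominates H near w
      (trans (cong (_+ 𝟙 (near w)) (proj₁ (same-degIn w≢v))) (far-neighbour⇒saturated 0<farDeg-G))

active-transfer : ∀ {n} (G H : Graph n) → (∀ w → deg G w ≡ deg H w) → ∀ v → Active H v → Active G v
active-transfer G H same-deg v active with activatingSwitch? G v
... | yes switch = switch⇒active G switch
... | no ¬switch = contradiction (active⇒switch H active)
    (inactive⇒¬switch H (InactiveTransfer.H-inactive G H v (¬switch⇒inactive G ¬switch) same-deg))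

mainTheorem1 : (n : ℕ) (G H : Graph n)
    → (∀ v → deg G v ≡ deg H v)
    → ∀ v → Active G v ⇔ Active H v
mainTheorem1 n G H same-deg v =
  mk⇔ (active-transfer H G (sym ∘ same-deg) v) (active-transfer G H same-deg v)
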